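{- Let $n\ge2$, $m\ge2$, and let $\varepsilon:\{0,\dots,m-1\}^{n-1}\to\{0,\dots,m-1\}^{n-1}$ be an embedding of $S(n-1,m)$ into $K_m^{n-1}$. Let $\pi_0,\pi_1,\dots,\pi_{m-1},\pi_m$ be permutations of $\{0,\dots,m-1\}$ such that $\pi_i(j)=\pi_j(i)$ for all $i,j\in\{0,\dots,m-1\}$. Define $\varepsilon':\{0,\dots,m-1\}^n\to\{0,\dots,m-1\}^n$ by $$\varepsilon'(i,w_1,\dots,w_{n-1})=\bigl(\pi_m(i),\ \varepsilon(\pi_i(w_1),\dots,\pi_i(w_{n-1}))\bigr).$$ Then $\varepsilon'$ is an embedding of $S(n,m)$ into $K_m^n$.
   Context: For $n\ge1$, $m\ge2$, the Sierpinski graph $S(n,m)$ has vertex set $\{0,1,\dots,m-1\}^n$, and two distinct vertices $u,v$ are adjacent iff there exists $h\in\{1,\dots,n\}$ such that: $u_i=v_i$ for $i<h$; $u_h\neq v_h$; and $u_j=v_h$, $v_j=u_h$ for all $j>h$. The Hamming graph $K_m^n$ has vertex set $\{0,1,\dots,m-1\}^n$, two vertices adjacent iff they differ in exactly one coordinate. An embedding of a graph $G$ into a graph $H$ is an injective map $V(G)\to V(H)$ sending every edge of $G$ to an edge of $H$ (i.e. an isomorphism of $G$ onto a subgraph of $H$). For a permutation $\pi$ of $\{0,\dots,m-1\}$, applying $\pi$ coordinatewise is an automorphism of $S(n-1,m)$. -}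

module Defs where

open import Data.Nat using (ℕ; zero; suc)
open import Data.Fin using (Fin; zero; suc; inject₁; fromℕ)
open import Data.Vec using (Vec; []; _∷_; map)
open import Data.Vec.Relation.Unary.All using (All)
open import Data.Empty using (⊥)
open import Data.Product using (_×_)
open import Data.Sum using (_⊎_)
open import Relation.Binary.PropositionalEquality using (_≡_; _≢_)
open import Function.Bundles using (_↔_; Inverse)

Word : ℕ → ℕ → Set
Word n m = Vec (Fin m) n

-- Sierpinski adjacency S(n,m): u ~ v iff there is h with u_i = v_i (i<h),
-- u_h ≠ v_h, u_j = v_h and v_j = u_h for j > h.  Stated recursively on
-- the first coordinate: either the first letters agree and the tails are
-- adjacent (h > 1), or h = 1.
SAdj : ∀ {n m} → Word n m → Word n m → Set
SAdj [] [] = ⊥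
SAdj (x ∷ u) (y ∷ v) =
  (x ≡ y × SAdj u v) ⊎ (x ≢ y × All (_≡ y) u × All (_≡ x) v)

HAdj : ∀ {n m} → Word n m → Word n m → Set
HAdj [] [] = ⊥
HAdj (x ∷ u) (y ∷ v) = (x ≡ y × HAdj u v) ⊎ (x ≢ y × u ≡ v)

IsEmbeddingSK : ∀ {n m} → (Word n m → Word n m) → Set
IsEmbeddingSK {n} {m} f =
  (∀ (u v : Word n m) → f u ≡ f v → u ≡ v) ×
  (∀ (u v : Word n m) → SAdj u v → HAdj (f u) (f v))

Perm : ℕ → Set
Perm m = Fin m ↔ Fin m

apply : ∀ {m} → Perm m → Fin m → Fin m
apply π = Inverse.to π

-- The construction ε'(i, w) = (π_m(i), ε(π_i(w_1),…,π_i(w_{n-1}))),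
-- where the family π is indexed by {0,…,m} = Fin (suc m).
extend : ∀ {k m} → (Word k m → Word k m) → (Fin (suc m) → Perm m)
       → Word (suc k) m → Word (suc k) m
extend {m = m} ε π (i ∷ w) =
  apply (π (fromℕ m)) i ∷ ε (map (apply (π (inject₁ i))) w)

-- The first letter of ε'(u) is π_m(u₁), so injectivity and adjacency split along
-- the first coordinate.  If u₁ = v₁, both tails are relabelled by the same
-- permutation π_{u₁}, an automorphism of S(k,m), and ε handles the rest.  If u₁ ≠ v₁
-- and u ~ v, then u = i jj…j and v = j ii…i, and the tails of ε'(u), ε'(v) are
-- ε of the constant words π_i(j)…π_i(j) and π_j(i)…π_j(i); these coincide by
-- the symmetry π_i(j) = π_j(i), so ε'(u) and ε'(v) differ only in the first letter.
module Submission where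

open import Defs
open import Data.Nat using (ℕ; suc; _≥_)
open import Data.Fin using (Fin; inject₁; fromℕ)
open import Data.Vec using (Vec; []; _∷_; map; replicate)
open import Data.Vec.Properties using (∷-injective; map-replicate)
open import Data.Vec.Relation.Unary.All as All using (All; []; _∷_)
open import Data.Vec.Relation.Unary.All.Properties using (map⁺)
open import Data.Product using (_,_)
open import Data.Sum using (inj₁; inj₂)
open import Function.Bundles using (Injection)
open import Function.Definitions using (Injective)
open import Function.Properties.Inverse using (↔⇒↣)
open import Relation.Binary.PropositionalEquality
  using (_≡_; refl; sym; cong; cong₂; module ≡-Reasoning)

private
  variable
    A : Set
    k m : ℕ

apply-injective : (π : Perm m) → Injective _≡_ _≡_ (apply π)
apply-injective π = Injection.injective (↔⇒↣ π)

map-injective : {f : A → A} → Injective _≡_ _≡_ f →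
                Injective _≡_ _≡_ (map {n = k} f)
map-injective f-inj {[]}    {[]}    _  = refl
map-injective f-inj {x ∷ u} {y ∷ v} eq =
  let x≡y , u≡v = ∷-injective eq
  in cong₂ _∷_ (f-inj x≡y) (map-injective f-inj u≡v)

All-≡⇒≡replicate : {a : A} {u : Vec A k} → All (_≡ a) u → u ≡ replicate k a
All-≡⇒≡replicate []         = refl
All-≡⇒≡replicate (refl ∷ p) = cong (_ ∷_) (All-≡⇒≡replicate p)

SAdj-map : {f : Fin m → Fin m} → Injective _≡_ _≡_ f →
           {u v : Word k m} → SAdj u v → SAdj (map f u) (map f v)
SAdj-map f-inj {[]} {[]} ()
SAdj-map {f = f} f-inj {x ∷ u} {y ∷ v} (inj₁ (x≡y , u~v)) =
  inj₁ (cong f x≡y , SAdj-map f-inj u~v)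
SAdj-map {f = f} f-inj {x ∷ u} {y ∷ v} (inj₂ (x≢y , u≡y , v≡x)) =
  inj₂ ((λ fx≡fy → x≢y (f-inj fx≡fy)) ,
        map⁺ (All.map (cong f) u≡y) , map⁺ (All.map (cong f) v≡x))

map-constants-≡ : {f g : A → A} {a b : A} {u v : Vec A k} →
                  All (_≡ a) u → All (_≡ b) v → f a ≡ g b → map f u ≡ map g v
map-constants-≡ {k = k} {f = f} {g} {a} {b} {u} {v} u≡a v≡b fa≡gb = begin
  map f u               ≡⟨ cong (map f) (All-≡⇒≡replicate u≡a) ⟩
  map f (replicate k a) ≡⟨ map-replicate f a k ⟩
  replicate k (f a)     ≡⟨ cong (replicate k) fa≡gb ⟩
  replicate k (g b)     ≡⟨ map-replicate g b k ⟨
  map g (replicate k b) ≡⟨ cong (map g) (All-≡⇒≡replicate v≡b) ⟨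
  map g v               ∎
  where open ≡-Reasoning

module _ (ε : Word k m → Word k m) (π : Fin (suc m) → Perm m) where

  extend-injective : (∀ u v → ε u ≡ ε v → u ≡ v) →
                     ∀ u v → extend ε π u ≡ extend ε π v → u ≡ v
  extend-injective ε-inj (i ∷ w) (j ∷ w') eq
    with head≡ , tail≡ ← ∷-injective eq
    with refl ← apply-injective (π (fromℕ m)) head≡ =
    cong (i ∷_) (map-injective (apply-injective (π (inject₁ i))) (ε-inj _ _ tail≡))

  extend-preserves-adjacency :
    (∀ u v → SAdj u v → HAdj (ε u) (ε v)) →
    (∀ i j → apply (π (inject₁ i)) j ≡ apply (π (inject₁ j)) i) →
    ∀ u v → SAdj u v → HAdj (extend ε π u) (extend ε π v)
  extend-preserves-adjacency ε-adj π-sym (i ∷ w) (j ∷ w') (inj₁ (refl , w~w')) =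
    inj₁ (refl , ε-adj _ _ (SAdj-map (apply-injective (π (inject₁ i))) w~w'))
  extend-preserves-adjacency ε-adj π-sym (i ∷ w) (j ∷ w') (inj₂ (i≢j , w≡j , w'≡i)) =
    inj₂ ((λ πi≡πj → i≢j (apply-injective (π (fromℕ m)) πi≡πj)) ,
          cong ε (map-constants-≡ w≡j w'≡i (π-sym i j)))

-- The bounds k ≥ 1 and m ≥ 2 only exclude degenerate cases; the construction
-- works without them.
theorem7 : (k m : ℕ) → k ≥ 1 → m ≥ 2 →
    (ε : Word k m → Word k m) → IsEmbeddingSK ε →
    (π : Fin (suc m) → Perm m) →
    (∀ (i j : Fin m) → apply (π (inject₁ i)) j ≡ apply (π (inject₁ j)) i) →
    IsEmbeddingSK (extend ε π)
theorem7 k m _ _ ε (ε-inj , ε-adj) π π-sym =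
  extend-injective ε π ε-inj , extend-preserves-adjacency ε π ε-adj π-sym
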